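{- Let $\sigma$ be a permutation of $\{1,2,\dots,n\}$ that is a single cycle $(x_1\ x_2\ \cdots\ x_k)$, $k\ge1$ (fixing all other points). If $|\sigma(x)-x|\le 2$ for all $x\in\{1,\dots,n\}$, then either $X=\{x_1,\dots,x_k\}$ is a set of consecutive integers and $\sigma=\sigma_X$ or $\sigma=\sigma_X^{ -1}$, or $k=2$ and $|x_1-x_2|=2$.
   Context: Cycle notation $(a_1\ a_2\ \cdots\ a_m)$ denotes the permutation sending $a_1\mapsto a_2\mapsto\cdots\mapsto a_m\mapsto a_1$ and fixing everything else. For a nonempty set of consecutive integers $X=\{b,b+1,\dots,a\}$, $\sigma_X$ is the permutation of $X$ (extended by the identity elsewhere) given by: if $|X|$ is odd, $\sigma_X=(b\ \ b{+}2\ \ b{+}4\ \cdots\ a{ - }2\ \ a\ \ a{ - }1\ \ a{ - }3\ \cdots\ b{+}1)$; if $|X|$ is even, $\sigma_X=(b\ \ b{+}2\ \ b{+}4\ \cdots\ a{ - }1\ \ a\ \ a{ - }2\ \ a{ - }4\ \cdots\ b{+}1)$. (If $|X|=1$ it is the identity; if $|X|=2$ it is a transposition.) -}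

module Defs where

open import Data.Nat using (ℕ; zero; suc; _+_; _*_; _∸_; ⌊_/2⌋; ⌈_/2⌉; _≡ᵇ_)
open import Data.Bool using (if_then_else_)
open import Data.List using (List; []; _∷_; map; upTo; reverse; _++_)

-- Cycle notation (a₁ a₂ ⋯ aₘ) as a function on ℕ:
-- aᵢ ↦ aᵢ₊₁, aₘ ↦ a₁, every other point fixed.
-- (Meaningful as a cycle when the list has no repetitions.)
cycleGo : ℕ → List ℕ → ℕ → ℕ
cycleGo h []            x = x
cycleGo h (y ∷ [])      x = if x ≡ᵇ y then h else x
cycleGo h (y ∷ z ∷ r)   x = if x ≡ᵇ y then z else cycleGo h (z ∷ r) x

cycle : List ℕ → ℕ → ℕ
cycle []       x = x
cycle (h ∷ t)  x = cycleGo h (h ∷ t) x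

-- For m odd this is  b b+2 ⋯ a-2 a a-1 a-3 ⋯ b+1,
-- for m even this is b b+2 ⋯ a-1 a a-2 ⋯ b+1   (a = b+m-1),
-- exactly as in the paper's definition of σ_X.
sigmaList : ℕ → ℕ → List ℕ
sigmaList b m =
  map (λ i → b + 2 * i) (upTo ⌈ m /2⌉)
  ++ reverse (map (λ i → b + 2 * i + 1) (upTo ⌊ m /2⌋))

sigmaX : ℕ → ℕ → ℕ → ℕ
sigmaX b a = cycle (sigmaList b (suc (a ∸ b)))

-- Rotate the cycle so that it starts at its least element b and read it as the closed path
-- b → ⋯ → b, whose steps have size at most 2; the last element before returning to b is then
-- b+1 or b+2. If it is b+1, the first step must go to b+2, and dropping b and reversing leaves a
-- path of the same kind from b+1 to b+2 on the elements above b. By induction the path is forced,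
-- and it is σ_X, because σ_X on {b, …, a} is b followed by the reversal of σ_X on {b+1, …, a}.
-- If it is b+2, the reversed cycle is of the first kind, giving σ_X⁻¹, unless the cycle is the
-- transposition (b b+2).

module Submission where

open import Defs
open import Level using (Level)
open import Function using (_∘_; Equivalence)
open import Data.Bool using (true; false; if_then_else_)
open import Data.Bool.Properties using (T-≡; ¬-not)
open import Data.Nat
  using (ℕ; zero; suc; _+_; _*_; _≤_; _<_; _≥_; ∣_-_∣; _≡ᵇ_; ⌊_/2⌋; ⌈_/2⌉; s≤s)
open import Data.Nat.Properties
  using ( _≟_; ≡ᵇ⇒≡; ≡⇒≡ᵇ; ≤-refl; ≤∧≢⇒<; <⇒≤; <⇒≱; m≤n⇒m<n∨m≡n; m≤m+n; m+n∸m≡n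
        ; +-identityʳ; +-suc; +-comm; ∣-∣-comm; ∣m-m+n∣≡n; suc-injective)
open import Data.Nat.Tactic.RingSolver using (solve-∀)
open import Data.Product using (∃-syntax; _×_; _,_; uncurry)
open import Data.Sum using (_⊎_; inj₁; inj₂)
import Data.Sum as Sum
open import Data.Empty using (⊥-elim)
open import Data.List
  using (List; []; _∷_; _++_; _ʳ++_; [_]; length; map; upTo; applyUpTo; reverse)
open import Data.List.Properties
  using ( ++-assoc; ++-identityʳ; map-cong; map-upTo; map-applyUpTo; reverse-++
        ; reverse-involutive; unfold-reverse; ʳ++-defn; length-reverse)
open import Data.List.Reverse using (reverseView; []; _∶_∶ʳ_)
open import Data.List.Extrema.Nat using (min; min≤⊤; min≤xs; argmin-sel)
open import Data.List.Membership.Propositional using (_∈_; _∉_)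
open import Data.List.Membership.Propositional.Properties using (∈-++⁺ˡ; ∈-++⁺ʳ; ∈-∃++)
open import Data.List.Membership.DecPropositional _≟_ using (_∈?_)
open import Data.List.Relation.Unary.Any using (here; there)
import Data.List.Relation.Unary.Any.Properties as Any
open import Data.List.Relation.Unary.All as All using (All; []; _∷_)
open import Data.List.Relation.Unary.All.Properties using (++⁻ˡ)
import Data.List.Relation.Unary.AllPairs as AllPairs
open import Data.List.Relation.Unary.Linked as Linked using (Linked; []; [-]; _∷_)
open import Data.List.Relation.Unary.Unique.Propositional using (Unique; _∷_)
open import Data.List.Relation.Unary.Unique.Propositional.Properties using (Unique[x∷xs]⇒x∉xs)
open import Data.List.Relation.Binary.Permutation.Propositional
  using (_↭_; ↭-sym; ↭-trans; ↭-reflexive; prep; ↭⇒↭ₛ)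
open import Data.List.Relation.Binary.Permutation.Propositional.Properties
  using (∈-resp-↭; All-resp-↭; ↭-reverse; ++-comm; shift)
import Data.List.Relation.Binary.Permutation.Setoid.Properties as Permutationₛ
open import Relation.Binary.Core using (Rel)
open import Relation.Binary.Definitions using (Symmetric)
open import Relation.Binary.PropositionalEquality
  using (_≡_; _≢_; refl; sym; trans; cong; cong₂; subst; setoid; module ≡-Reasoning)
open import Relation.Nullary using (¬_; yes; no)

private
  variable
    a ℓ : Level
    A : Set a

Unique-resp-↭ : {xs ys : List A} → xs ↭ ys → Unique xs → Unique ys
Unique-resp-↭ {A = A} p = Permutationₛ.Unique-resp-↭ (setoid A) (↭⇒↭ₛ p)

Unique-reverse : (xs : List A) → Unique xs → Unique (reverse xs)
Unique-reverse xs = Unique-resp-↭ (↭-sym (↭-reverse xs))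

↭-∷-reverse : ∀ (x : A) xs → x ∷ xs ↭ x ∷ reverse xs
↭-∷-reverse x xs = prep x (↭-sym (↭-reverse xs))

Unique-++⇒∉ : ∀ pre {y : A} post → Unique (pre ++ y ∷ post) → y ∉ pre
Unique-++⇒∉ pre post u y∈pre =
  Unique[x∷xs]⇒x∉xs (Unique-resp-↭ (shift _ pre post) u) (∈-++⁺ˡ y∈pre)

¬Unique-∷-++ : ∀ {x : A} xs → ¬ Unique (x ∷ xs ++ [ x ])
¬Unique-∷-++ xs u = Unique[x∷xs]⇒x∉xs u (∈-++⁺ʳ xs (here refl))

reverse-∷-++ : ∀ (x : A) xs y → reverse (x ∷ xs ++ [ y ]) ≡ y ∷ reverse xs ++ [ x ]
reverse-∷-++ x xs y = begin
  reverse (x ∷ xs ++ [ y ])      ≡⟨ unfold-reverse x (xs ++ [ y ]) ⟩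
  reverse (xs ++ [ y ]) ++ [ x ] ≡⟨ cong (_++ [ x ]) (reverse-++ xs [ y ]) ⟩
  y ∷ reverse xs ++ [ x ]        ∎
  where open ≡-Reasoning

reverse-++-∷-∷ : ∀ pre (x y : A) post →
                 reverse (pre ++ x ∷ y ∷ post) ≡ reverse post ++ y ∷ x ∷ reverse pre
reverse-++-∷-∷ pre x y post = begin
  reverse (pre ++ x ∷ y ∷ post)               ≡⟨ reverse-++ pre (x ∷ y ∷ post) ⟩
  reverse (x ∷ y ∷ post) ++ reverse pre       ≡⟨ cong (_++ reverse pre) (ʳ++-defn post) ⟩
  (reverse post ++ y ∷ x ∷ []) ++ reverse pre ≡⟨ ++-assoc (reverse post) _ _ ⟩
  reverse post ++ y ∷ x ∷ reverse pre         ∎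
  where open ≡-Reasoning

reverse-++-reverse : (xs ys : List A) → reverse (xs ++ reverse ys) ≡ ys ++ reverse xs
reverse-++-reverse xs ys =
  trans (reverse-++ xs (reverse ys)) (cong (_++ reverse xs) (reverse-involutive ys))

Linked-++⁻ˡ : {R : Rel A ℓ} (xs : List A) {ys : List A} → Linked R (xs ++ ys) → Linked R xs
Linked-++⁻ˡ []           _        = []
Linked-++⁻ˡ (x ∷ [])     _        = [-]
Linked-++⁻ˡ (x ∷ y ∷ xs) (r ∷ rs) = r ∷ Linked-++⁻ˡ (y ∷ xs) rs

module _ {R : Rel A ℓ} (R-sym : Symmetric R) where

  Linked-ʳ++ : ∀ {x} xs {ys} →
               Linked R (x ∷ xs) → Linked R (x ∷ ys) → Linked R (xs ʳ++ x ∷ ys)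
  Linked-ʳ++ []       _        acc = acc
  Linked-ʳ++ (y ∷ xs) (r ∷ rs) acc = Linked-ʳ++ xs rs (R-sym r ∷ acc)

  Linked-reverse : ∀ {xs} → Linked R xs → Linked R (reverse xs)
  Linked-reverse {[]}     _ = []
  Linked-reverse {x ∷ xs} l = Linked-ʳ++ xs l [-]

All-≤⇒< : ∀ {x xs} → x ∉ xs → All (x ≤_) xs → All (x <_) xs
All-≤⇒< x∉ []            = []
All-≤⇒< x∉ (x≤y ∷ x≤ys) = ≤∧≢⇒< x≤y (x∉ ∘ here) ∷ All-≤⇒< (x∉ ∘ there) x≤ys

∃-minimum : ∀ xs → length xs ≥ 1 → ∃[ b ] (b ∈ xs × All (b ≤_) xs)
∃-minimum (x ∷ xs) _ = min x xs , min∈ , min≤⊤ x xs ∷ min≤xs x xs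
  where
  min∈ : min x xs ∈ x ∷ xs
  min∈ = Sum.[ here , there ]′ (argmin-sel (λ y → y) x xs)

≡ᵇ-refl : ∀ x → (x ≡ᵇ x) ≡ true
≡ᵇ-refl x = Equivalence.to T-≡ (≡⇒≡ᵇ x x refl)

≢⇒≡ᵇ-false : ∀ {x y} → x ≢ y → (x ≡ᵇ y) ≡ false
≢⇒≡ᵇ-false {x} {y} x≢y = ¬-not (x≢y ∘ ≡ᵇ⇒≡ x y ∘ Equivalence.from T-≡)

cycleGo-here : ∀ h y z l → cycleGo h (y ∷ z ∷ l) y ≡ z
cycleGo-here h y z l rewrite ≡ᵇ-refl y = refl

cycleGo-last : ∀ h y → cycleGo h (y ∷ []) y ≡ h
cycleGo-last h y rewrite ≡ᵇ-refl y = refl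

cycleGo-skip : ∀ h y l x → x ≢ y → cycleGo h (y ∷ l) x ≡ cycleGo h l x
cycleGo-skip h y []      x x≢y rewrite ≢⇒≡ᵇ-false x≢y = refl
cycleGo-skip h y (_ ∷ _) x x≢y rewrite ≢⇒≡ᵇ-false x≢y = refl

cycleGo-∉ : ∀ h l x → x ∉ l → cycleGo h l x ≡ x
cycleGo-∉ h []      x _   = refl
cycleGo-∉ h (y ∷ l) x x∉ =
  trans (cycleGo-skip h y l x (x∉ ∘ here)) (cycleGo-∉ h l x (x∉ ∘ there))

cycle-∉ : ∀ l x → x ∉ l → cycle l x ≡ x
cycle-∉ []      x _ = refl
cycle-∉ (h ∷ t) x   = cycleGo-∉ h (h ∷ t) x

cycleGo-next : ∀ h pre y z post → y ∉ pre → cycleGo h (pre ++ y ∷ z ∷ post) y ≡ z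
cycleGo-next h []        y z post _   = cycleGo-here h y z post
cycleGo-next h (p ∷ pre) y z post y∉ =
  trans (cycleGo-skip h p (pre ++ y ∷ z ∷ post) y (y∉ ∘ here))
        (cycleGo-next h pre y z post (y∉ ∘ there))

cycle-next : ∀ pre y z post → y ∉ pre → cycle (pre ++ y ∷ z ∷ post) y ≡ z
cycle-next []        y = cycleGo-next y [] y
cycle-next (p ∷ pre)   = cycleGo-next p (p ∷ pre)

cycleGo-wrap : ∀ h l y → y ∉ l → cycleGo h (l ++ [ y ]) y ≡ h
cycleGo-wrap h []      y _   = cycleGo-last h y
cycleGo-wrap h (p ∷ l) y y∉ =
  trans (cycleGo-skip h p (l ++ [ y ]) y (y∉ ∘ here)) (cycleGo-wrap h l y (y∉ ∘ there))

cycleGo-++-[] : ∀ g h l x → x ≢ h → cycleGo g (l ++ [ h ]) x ≡ cycleGo h l x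
cycleGo-++-[] g h []          x x≢h = cycleGo-skip g h [] x x≢h
cycleGo-++-[] g h (p ∷ [])    x x≢h =
  cong (if x ≡ᵇ p then h else_) (cycleGo-skip g h [] x x≢h)
cycleGo-++-[] g h (p ∷ q ∷ l) x x≢h =
  cong (if x ≡ᵇ p then q else_) (cycleGo-++-[] g h (q ∷ l) x x≢h)

cycle-rotate₁ : ∀ h t → Unique (h ∷ t) → ∀ x → cycle (h ∷ t) x ≡ cycle (t ++ [ h ]) x
cycle-rotate₁ h []      _ x = refl
cycle-rotate₁ h (y ∷ t) u x with x ≟ h
... | yes refl =
  trans (cycleGo-here x x y t) (sym (cycleGo-wrap y (y ∷ t) x (Unique[x∷xs]⇒x∉xs u)))
... | no x≢h =
  trans (cycleGo-skip h h (y ∷ t) x x≢h) (sym (cycleGo-++-[] y h (y ∷ t) x x≢h))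

cycle-rotate : ∀ u w → Unique (u ++ w) → ∀ x → cycle (u ++ w) x ≡ cycle (w ++ u) x
cycle-rotate []      w _  x = cong (λ l → cycle l x) (sym (++-identityʳ w))
cycle-rotate (h ∷ u) w uq x = begin
  cycle (h ∷ u ++ w) x        ≡⟨ cycle-rotate₁ h (u ++ w) uq x ⟩
  cycle ((u ++ w) ++ [ h ]) x ≡⟨ cong (λ l → cycle l x) (++-assoc u w [ h ]) ⟩
  cycle (u ++ w ++ [ h ]) x   ≡⟨ cycle-rotate u (w ++ [ h ]) uq′ x ⟩
  cycle ((w ++ [ h ]) ++ u) x ≡⟨ cong (λ l → cycle l x) (++-assoc w [ h ] u) ⟩
  cycle (w ++ h ∷ u) x        ∎
  where
  open ≡-Reasoning
  uq′ : Unique (u ++ w ++ [ h ])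
  uq′ = subst Unique (++-assoc u w [ h ]) (Unique-resp-↭ (++-comm [ h ] (u ++ w)) uq)

cycle-reverse-inverse : ∀ xs → Unique xs → ∀ x → cycle (reverse xs) (cycle xs x) ≡ x
cycle-reverse-inverse xs u x with x ∈? xs
... | no x∉xs =
  trans (cong (cycle (reverse xs)) (cycle-∉ xs x x∉xs))
        (cycle-∉ (reverse xs) x (x∉xs ∘ Any.reverse⁻))
... | yes x∈xs with ∈-∃++ x∈xs
... | [] , [] , refl = trans (cong (cycle [ x ]) (cycleGo-last x x)) (cycleGo-last x x)
... | h ∷ m , [] , refl = begin
  cycle (reverse L) (cycle L x)
    ≡⟨ cong (cycle (reverse L)) (cycleGo-wrap h (h ∷ m) x (Unique-++⇒∉ (h ∷ m) [] u)) ⟩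
  cycle (reverse L) h
    ≡⟨ cong (λ l → cycle l h) reversed ⟩
  cycle (x ∷ reverse m ++ [ h ]) h
    ≡⟨ cycleGo-wrap x (x ∷ reverse m) h (Unique-++⇒∉ (x ∷ reverse m) [] u′) ⟩
  x ∎
  where
  open ≡-Reasoning
  L = h ∷ m ++ [ x ]
  reversed = reverse-∷-++ h m x
  u′ = subst Unique reversed (Unique-reverse L u)
... | pre , z ∷ post , refl = begin
  cycle (reverse L) (cycle L x)
    ≡⟨ cong (cycle (reverse L)) (cycle-next pre x z post (Unique-++⇒∉ pre _ u)) ⟩
  cycle (reverse L) z
    ≡⟨ cong (λ l → cycle l z) reversed ⟩
  cycle (reverse post ++ z ∷ x ∷ reverse pre) z
    ≡⟨ cycle-next (reverse post) z x _ (Unique-++⇒∉ (reverse post) _ u′) ⟩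
  x ∎
  where
  open ≡-Reasoning
  L = pre ++ x ∷ z ∷ post
  reversed = reverse-++-∷-∷ pre x z post
  u′ = subst Unique reversed (Unique-reverse L u)

cycleGo-linked : {R : Rel ℕ ℓ} → ∀ h l → Unique l →
                 (∀ y → y ∈ l → R y (cycleGo h l y)) → Linked R (l ++ [ h ])
cycleGo-linked         h []          _       _    = [-]
cycleGo-linked {R = R} h (y ∷ [])    _       near =
  subst (R y) (cycleGo-last h y) (near y (here refl)) ∷ [-]
cycleGo-linked {R = R} h (y ∷ z ∷ l) (y∉ ∷ u) near =
  subst (R y) (cycleGo-here h y z l) (near y (here refl)) ∷ cycleGo-linked h (z ∷ l) u near′
  where
  near′ : ∀ x → x ∈ z ∷ l → R x (cycleGo h (z ∷ l) x)
  near′ x x∈ =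
    subst (R x) (cycleGo-skip h y (z ∷ l) x (All.lookup y∉ x∈ ∘ sym)) (near x (there x∈))

sigmaList-suc : ∀ b m → sigmaList b (suc m) ≡ b ∷ reverse (sigmaList (suc b) m)
sigmaList-suc b m = begin
  map even (upTo (suc q)) ++ reverse (map odd (upTo p))
    ≡⟨ cong₂ (λ xs ys → xs ++ reverse ys) evens odds ⟩
  b ∷ map odd′ (upTo q) ++ reverse (map even′ (upTo p))
    ≡⟨ cong (b ∷_) (sym (reverse-++-reverse (map even′ (upTo p)) (map odd′ (upTo q)))) ⟩
  b ∷ reverse (map even′ (upTo p) ++ reverse (map odd′ (upTo q))) ∎
  where
  open ≡-Reasoning
  p = ⌈ m /2⌉
  q = ⌊ m /2⌋
  even odd even′ odd′ : ℕ → ℕ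
  even  i = b + 2 * i
  odd   i = b + 2 * i + 1
  even′ i = suc b + 2 * i
  odd′  i = suc b + 2 * i + 1
  even-suc : ∀ b i → b + 2 * suc i ≡ suc b + 2 * i + 1
  even-suc = solve-∀
  odd≡even′ : ∀ b i → b + 2 * i + 1 ≡ suc b + 2 * i
  odd≡even′ = solve-∀
  evens : map even (upTo (suc q)) ≡ b ∷ map odd′ (upTo q)
  evens = cong₂ _∷_ (+-identityʳ b) (begin
    map even (applyUpTo suc q) ≡⟨ map-applyUpTo suc even q ⟩
    applyUpTo (even ∘ suc) q   ≡⟨ sym (map-upTo (even ∘ suc) q) ⟩
    map (even ∘ suc) (upTo q)  ≡⟨ map-cong (even-suc b) (upTo q) ⟩
    map odd′ (upTo q)          ∎)
  odds : map odd (upTo p) ≡ map even′ (upTo p)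
  odds = map-cong (odd≡even′ b) (upTo p)

∈-sigmaList⁻ : ∀ b m {y} → y ∈ sigmaList b (suc m) → b ≤ y × y ≤ b + m
∈-sigmaList⁻ b m {y} y∈ with subst (y ∈_) (sigmaList-suc b m) y∈
∈-sigmaList⁻ b m           _ | here refl = ≤-refl , m≤m+n b m
∈-sigmaList⁻ b zero        _ | there ()
∈-sigmaList⁻ b (suc m) {y} _ | there y∈′ with ∈-sigmaList⁻ (suc b) m (Any.reverse⁻ y∈′)
... | b<y , y≤ = <⇒≤ b<y , subst (y ≤_) (sym (+-suc b m)) y≤

∈-sigmaList⁺ : ∀ b m {y} → b ≤ y → y ≤ b + m → y ∈ sigmaList b (suc m)
∈-sigmaList⁺ b m {y} b≤y y≤ with m≤n⇒m<n∨m≡n b≤y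
... | inj₂ refl = subst (b ∈_) (sym (sigmaList-suc b m)) (here refl)
∈-sigmaList⁺ b zero    {y} _ y≤ | inj₁ b<y =
  ⊥-elim (<⇒≱ b<y (subst (y ≤_) (+-identityʳ b) y≤))
∈-sigmaList⁺ b (suc m) {y} _ y≤ | inj₁ b<y =
  subst (y ∈_) (sym (sigmaList-suc b (suc m)))
    (there (Any.reverse⁺ (∈-sigmaList⁺ (suc b) m b<y (subst (y ≤_) (+-suc b m) y≤))))

Near : ℕ → ℕ → Set
Near x y = ∣ x - y ∣ ≤ 2

near-sym : ∀ x y → Near x y → Near y x
near-sym x y = subst (_≤ 2) (∣-∣-comm x y)

near-above : ∀ b y → b < y → Near b y → y ≡ suc b ⊎ y ≡ suc (suc b)
near-above zero    zero                ()        _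
near-above (suc b) zero                ()        _
near-above zero    (suc zero)          _         _ = inj₁ refl
near-above zero    (suc (suc zero))    _         _ = inj₂ refl
near-above zero    (suc (suc (suc y))) _         (s≤s (s≤s ()))
near-above (suc b) (suc y)             (s≤s b<y) near =
  Sum.map (cong suc) (cong suc) (near-above b y b<y near)

record PathNear (b : ℕ) (p : List ℕ) : Set where
  field
    unique : Unique (b ∷ p)
    above  : All (b <_) p
    linked : Linked Near (b ∷ p)

PathNear-head : ∀ {b y p} → PathNear b (y ∷ p) → y ≡ suc b ⊎ y ≡ suc (suc b)
PathNear-head path = near-above _ _ (All.head above) (Linked.head linked)
  where open PathNear path

PathNear-reflect : ∀ {b} T → PathNear b (T ++ [ suc b ]) → PathNear (suc b) (reverse T)
PathNear-reflect {b} T path = record { unique = unique′ ; above = above′ ; linked = linked′ }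
  where
  open PathNear path
  reversed : reverse (T ++ [ suc b ]) ≡ suc b ∷ reverse T
  reversed = reverse-++ T [ suc b ]
  unique′ = subst Unique reversed (Unique-reverse _ (AllPairs.tail unique))
  above′  = All-≤⇒< (Unique[x∷xs]⇒x∉xs unique′)
                    (All-resp-↭ (↭-sym (↭-reverse T)) (++⁻ˡ T above))
  linked′ = subst (Linked Near) reversed
                  (Linked-reverse (λ {x} {y} → near-sym x y) (Linked.tail linked))

-- The first step from b leads to b+2, since b+1 closes the path; reversing the rest yields a path
-- of the same kind one level up. The length counter n makes this recursion on reverse M structural.
near-path≡sigmaList : ∀ n b M → length M ≡ n → PathNear b (M ++ [ suc b ]) →
                      b ∷ M ++ [ suc b ] ≡ sigmaList b (2 + n)
near-path≡sigmaList zero    b []      _   _    = begin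
  b ∷ suc b ∷ []                    ≡⟨ cong (λ l → b ∷ reverse l) (sym (sigmaList-suc (suc b) 0)) ⟩
  b ∷ reverse (sigmaList (suc b) 1) ≡⟨ sym (sigmaList-suc b 1) ⟩
  sigmaList b 2                     ∎
  where open ≡-Reasoning
near-path≡sigmaList zero    b (_ ∷ _) ()  _
near-path≡sigmaList (suc n) b []      ()  _
near-path≡sigmaList (suc n) b (y ∷ M) len path with PathNear-head path
... | inj₁ refl = ⊥-elim (¬Unique-∷-++ M (AllPairs.tail (PathNear.unique path)))
... | inj₂ refl = begin
  b ∷ T                                   ≡⟨ cong (b ∷_) (sym (reverse-involutive T)) ⟩
  b ∷ reverse (reverse T)                 ≡⟨ cong (λ l → b ∷ reverse l) reversed ⟩
  b ∷ reverse R                           ≡⟨ cong (λ l → b ∷ reverse l) R≡sigmaList ⟩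
  b ∷ reverse (sigmaList (suc b) (2 + n)) ≡⟨ sigmaList-suc b (2 + n) ⟨
  sigmaList b (3 + n)                     ∎
  where
  open ≡-Reasoning
  T = suc (suc b) ∷ M ++ [ suc b ]
  R = suc b ∷ reverse M ++ [ suc (suc b) ]
  reversed : reverse T ≡ R
  reversed = reverse-∷-++ (suc (suc b)) M (suc b)
  path′ : PathNear (suc b) (reverse M ++ [ suc (suc b) ])
  path′ = subst (PathNear (suc b)) (unfold-reverse (suc (suc b)) M)
                (PathNear-reflect (suc (suc b) ∷ M) path)
  R≡sigmaList : R ≡ sigmaList (suc b) (2 + n)
  R≡sigmaList = near-path≡sigmaList n (suc b) (reverse M)
                  (trans (length-reverse M) (suc-injective len)) path′

data CycleShape (b : ℕ) (p : List ℕ) : Set where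
  ascending     : ∀ m → b ∷ p ≡ sigmaList b (suc m) → CycleShape b p
  descending    : ∀ m → b ∷ reverse p ≡ sigmaList b (suc m) → CycleShape b p
  transposition : p ≡ suc (suc b) ∷ [] → CycleShape b p

cycle-shape : ∀ b p → PathNear b p → PathNear b (reverse p) → CycleShape b p
cycle-shape b p fwd bwd with reverseView p
... | [] = ascending 0 (sym (sigmaList-suc b 0))
... | M ∶ _ ∶ʳ l with PathNear-head (subst (PathNear b) (reverse-++ M [ l ]) bwd)
...   | inj₁ refl = ascending (suc (length M)) (near-path≡sigmaList _ b M refl fwd)
...   | inj₂ refl with M
...     | [] = transposition refl
...     | f ∷ M′ with PathNear-head fwd
...       | inj₂ refl = ⊥-elim (¬Unique-∷-++ M′ (AllPairs.tail (PathNear.unique fwd)))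
...       | inj₁ refl = descending (2 + length (reverse M′)) (trans (cong (b ∷_) reversed)
  (near-path≡sigmaList _ b (suc (suc b) ∷ reverse M′) refl (subst (PathNear b) reversed bwd)))
  where
  reversed : reverse (suc b ∷ M′ ++ [ suc (suc b) ]) ≡ suc (suc b) ∷ reverse M′ ++ [ suc b ]
  reversed = reverse-∷-++ (suc b) M′ (suc (suc b))

PathNear-from-minimum : ∀ u b v → Unique (u ++ b ∷ v) → All (b ≤_) (u ++ b ∷ v) →
                (∀ y → y ∈ u ++ b ∷ v → Near (cycle (u ++ b ∷ v) y) y) →
                PathNear b (v ++ u) × PathNear b (reverse (v ++ u))
PathNear-from-minimum u b v uq b≤ near = forward , backward
  where
  p = v ++ u
  rotation : u ++ b ∷ v ↭ b ∷ p
  rotation = ++-comm u (b ∷ v)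
  unique : Unique (b ∷ p)
  unique = Unique-resp-↭ rotation uq
  above : All (b <_) p
  above = All-≤⇒< (Unique[x∷xs]⇒x∉xs unique) (All.tail (All-resp-↭ rotation b≤))
  closed : Linked Near (b ∷ p ++ [ b ])
  closed = cycleGo-linked b (b ∷ p) unique λ y y∈ →
    near-sym (cycle (b ∷ p) y) y
      (subst (λ z → Near z y) (cycle-rotate u (b ∷ v) uq y) (near y (∈-resp-↭ (↭-sym rotation) y∈)))
  forward : PathNear b p
  forward = record { unique = unique ; above = above ; linked = Linked-++⁻ˡ (b ∷ p) closed }
  backward : PathNear b (reverse p)
  backward = record
    { unique = Unique-resp-↭ (↭-∷-reverse b p) unique
    ; above  = All-resp-↭ (↭-sym (↭-reverse p)) above
    ; linked = Linked-++⁻ˡ (b ∷ reverse p) (subst (Linked Near) (reverse-∷-++ b p b)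
                 (Linked-reverse (λ {x} {y} → near-sym x y) closed))
    }

↭-sigmaList⇒interval : ∀ {xs} b m → xs ↭ sigmaList b (suc m) →
                       ∀ y → (y ∈ xs → b ≤ y × y ≤ b + m) × (b ≤ y → y ≤ b + m → y ∈ xs)
↭-sigmaList⇒interval b m xs↭ y =
  ∈-sigmaList⁻ b m ∘ ∈-resp-↭ xs↭ , λ b≤y y≤ → ∈-resp-↭ (↭-sym xs↭) (∈-sigmaList⁺ b m b≤y y≤)

sigmaX-+ : ∀ b m x → sigmaX b (b + m) x ≡ cycle (sigmaList b (suc m)) x
sigmaX-+ b m x rewrite m+n∸m≡n b m = refl

cycle-∷-reverse-inverse : ∀ b p → Unique (b ∷ p) → ∀ x → cycle (b ∷ reverse p) (cycle (b ∷ p) x) ≡ x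
cycle-∷-reverse-inverse b p u x = begin
  cycle (b ∷ reverse p) y      ≡⟨ cycle-rotate₁ b (reverse p) (Unique-resp-↭ (↭-∷-reverse b p) u) y ⟩
  cycle (reverse p ++ [ b ]) y ≡⟨ cong (λ l → cycle l y) (unfold-reverse b p) ⟨
  cycle (reverse (b ∷ p)) y    ≡⟨ cycle-reverse-inverse (b ∷ p) u x ⟩
  x                            ∎
  where
  open ≡-Reasoning
  y = cycle (b ∷ p) x

∣n-2+n∣≡2 : ∀ n → ∣ n - 2 + n ∣ ≡ 2
∣n-2+n∣≡2 n = trans (cong (∣ n -_∣) (+-comm 2 n)) (∣m-m+n∣≡n n 2)

pair-rotation : ∀ u (b : ℕ) v → v ++ u ≡ suc (suc b) ∷ [] →
                ∃[ x₁ ] ∃[ x₂ ] (u ++ b ∷ v ≡ x₁ ∷ x₂ ∷ [] × ∣ x₁ - x₂ ∣ ≡ 2)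
pair-rotation _       b []          refl = 2 + b , b , refl , trans (∣-∣-comm (2 + b) b) (∣n-2+n∣≡2 b)
pair-rotation []      b (_ ∷ [])    refl = b , 2 + b , refl , ∣n-2+n∣≡2 b
pair-rotation (_ ∷ _) b (_ ∷ [])    ()
pair-rotation _       b (_ ∷ _ ∷ _) ()

proposition5p2 : (n : ℕ) (xs : List ℕ) →
    length xs ≥ 1 →
    Unique xs →
    All (λ x → 1 ≤ x × x ≤ n) xs →
    (∀ x → 1 ≤ x → x ≤ n → ∣ cycle xs x - x ∣ ≤ 2) →
    (∃[ b ] ∃[ a ] (b ≤ a × (∀ y → (y ∈ xs → b ≤ y × y ≤ a) × (b ≤ y → y ≤ a → y ∈ xs))
        × ((∀ x → cycle xs x ≡ sigmaX b a x) ⊎ (∀ x → sigmaX b a (cycle xs x) ≡ x))))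
    ⊎ (∃[ x₁ ] ∃[ x₂ ] (xs ≡ x₁ ∷ x₂ ∷ [] × ∣ x₁ - x₂ ∣ ≡ 2))
proposition5p2 n xs len uq bounded near with ∃-minimum xs len
... | b , b∈xs , b≤xs with ∈-∃++ b∈xs
... | u , v , refl with uncurry (cycle-shape b (v ++ u)) (PathNear-from-minimum u b v uq b≤xs
                          (λ y y∈ → uncurry (near y) (All.lookup bounded y∈)))
... | ascending m eq = inj₁ (b , b + m , m≤m+n b m ,
  ↭-sigmaList⇒interval b m (↭-trans (++-comm u (b ∷ v)) (↭-reflexive eq)) ,
  inj₁ λ x → begin
    cycle (u ++ b ∷ v) x          ≡⟨ cycle-rotate u (b ∷ v) uq x ⟩
    cycle (b ∷ v ++ u) x          ≡⟨ cong (λ l → cycle l x) eq ⟩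
    cycle (sigmaList b (suc m)) x ≡⟨ sigmaX-+ b m x ⟨
    sigmaX b (b + m) x            ∎)
  where open ≡-Reasoning
... | descending m eq = inj₁ (b , b + m , m≤m+n b m ,
  ↭-sigmaList⇒interval b m (↭-trans (++-comm u (b ∷ v)) (↭-trans (↭-∷-reverse b (v ++ u)) (↭-reflexive eq))) ,
  inj₂ λ x → begin
    sigmaX b (b + m) (cycle (u ++ b ∷ v) x)             ≡⟨ sigmaX-+ b m _ ⟩
    cycle (sigmaList b (suc m)) (cycle (u ++ b ∷ v) x)  ≡⟨ cong₂ cycle (sym eq) (cycle-rotate u (b ∷ v) uq x) ⟩
    cycle (b ∷ reverse (v ++ u)) (cycle (b ∷ v ++ u) x) ≡⟨ cycle-∷-reverse-inverse b (v ++ u) uq′ x ⟩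
    x                                                   ∎)
  where
  open ≡-Reasoning
  uq′ = Unique-resp-↭ (++-comm u (b ∷ v)) uq
... | transposition eq = inj₂ (pair-rotation u b v eq)
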